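{- For $n\ge1$, let $I_{2n}$ be the set of fixed-point-free involutions in $S_{2n}$. For $\pi\in I_{2n}$, let $P_1(\pi)$ be the number of cards in the first pile when patience sorting is applied to the sequence $\pi(1),\pi(2),\dots,\pi(2n)$. Then $$\sum_{\pi\in I_{2n}}x^{P_1(\pi)}=\prod_{i=1}^n\bigl(x^2+2(i-1)\bigr).$$
   Context: Patience sorting: the values are turned up one at a time and dealt into piles arranged left to right; each value is placed on the leftmost pile whose top value is higher; if no such pile exists, it starts a new pile to the right. -}

module Defs where

open import Data.Nat using (ℕ; zero; suc; _+_)
open import Data.Fin using (Fin; toℕ; _<?_) renaming (_≟_ to _≟ᶠ_)
open import Data.Fin.Properties using (all?)
open import Data.List using (List; []; _∷_; foldl; concatMap; map; filter; allFin)
open import Data.List.NonEmpty using (List⁺; [_]; _∷⁺_) renaming (head to top; length to length⁺)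
open import Data.Vec using (Vec; []; _∷_; lookup; toList)
open import Data.Product using (_×_)
open import Relation.Binary.PropositionalEquality using (_≡_; _≢_)
open import Relation.Nullary using (yes; no; ¬?)
open import Relation.Nullary.Decidable using (_×-dec_)
open import Relation.Unary using (Decidable)

allVecs : (m k : ℕ) → List (Vec (Fin m) k)
allVecs m zero    = [] ∷ []
allVecs m (suc k) = concatMap (λ i → map (i ∷_) (allVecs m k)) (allFin m)

-- A fixed-point-free involution of {0,…,m-1}, given in one-line notation v = (π(0),…,π(m-1)).
IsFPFInvolution : {m : ℕ} → Vec (Fin m) m → Set
IsFPFInvolution {m} v = (i : Fin m) → (lookup v (lookup v i) ≡ i) × (lookup v i ≢ i)

isFPFInvolution? : {m : ℕ} → Decidable (IsFPFInvolution {m})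
isFPFInvolution? v = all? (λ i → (lookup v (lookup v i) ≟ᶠ i) ×-dec ¬? (lookup v i ≟ᶠ i))

FPFInvolutions : (m : ℕ) → List (Vec (Fin m) m)
FPFInvolutions m = filter isFPFInvolution? (allVecs m m)

-- Patience sorting. Piles are listed left to right; each pile is a nonempty
-- list whose head is its top card.
Piles : ℕ → Set
Piles m = List (List⁺ (Fin m))

place : {m : ℕ} → Fin m → Piles m → Piles m
place x [] = [ x ] ∷ []
place x (p ∷ ps) with x <? top p
... | yes _ = (x ∷⁺ p) ∷ ps
... | no  _ = p ∷ place x ps

patience : {m : ℕ} → List (Fin m) → Piles m
patience = foldl (λ ps x → place x ps) []

firstPileSize : {m : ℕ} → Piles m → ℕ
firstPileSize []      = 0
firstPileSize (p ∷ _) = length⁺ p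

P₁ : {m : ℕ} → Vec (Fin m) m → ℕ
P₁ v = firstPileSize (patience (toList v))

-- P₁(π) is the number of left-to-right minima of π(0), …, π(m-1): a card lands on the
-- first pile exactly when it is smaller than every earlier card. Write an involution
-- on the points 0, …, m+1 as its partner a of the last point m+1 together with the
-- involution w it induces on the remaining m points, renumbered in order. If a = 0, the
-- sequence starts with m+1 and ends with 0, two new left-to-right minima, and in between
-- it is order-isomorphic to w, so P₁ grows by 2. If a > 0, the first entry is below
-- m+1 and the value 0 occurs before the last entry, so neither new entry is a minimum
-- and P₁ is unchanged. Summing over the m+1 choices of a gives
-- Σ_{I(m+2)} x^P₁ = (x² + m) · Σ_{I(m)} x^P₁.

module Submission where

open import Defs
open import Data.Nat using (ℕ; zero; suc; _+_; _*_; _^_; _<_; _≤_; _<?_; z≤n; z<s)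
open import Data.Nat.Properties
  using ( ≤-refl; ≤-trans; <⇒≤; <⇒≱; ≮⇒≥; ≰⇒>; +-identityʳ; +-suc; *-comm; *-suc; *-zeroʳ
        ; *-identityʳ; *-distribˡ-+; *-distribʳ-+; ^-distribˡ-+-* )
open import Data.Nat.ListAction using (sum; product)
open import Data.Nat.ListAction.Properties using (sum-++; sum-↭; product-++)
open import Data.Fin using (Fin; toℕ; inject₁; fromℕ; punchIn; punchOut)
  renaming (_≟_ to _≟ᶠ_; _<?_ to _<ᶠ?_)
open import Data.Fin.Properties
  using ( toℕ<n; toℕ-fromℕ; toℕ-inject₁; ≤fromℕ; inject₁ℕ<; inject₁-injective; fromℕ≢inject₁
        ; punchIn-injective; punchInᵢ≢i; punchIn-punchOut; punchIn-mono-≤; punchIn-cancel-≤ )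
open import Data.Fin.Relation.Unary.Top using (view; ‵fromℕ; ‵inject₁)
open import Data.List
  using ( List; []; _∷_; _++_; [_]; map; foldl; concatMap; cartesianProductWith; allFin
        ; tabulate; upTo )
open import Data.List.Properties
  using (map-++; map-∘; map-cong; map-cong-local; map-tabulate; ++-assoc; ++-identityʳ; upTo-∷ʳ)
open import Data.List.NonEmpty using (List⁺; _∷⁺_)
  renaming (head to top; length to length⁺; [_] to [_]⁺)
open import Data.List.Membership.Propositional using (_∈_)
open import Data.List.Membership.Propositional.Properties
  using ( ∈-map⁺; ∈-allFin; ∈-filter⁺; ∈-filter⁻
        ; ∈-cartesianProductWith⁺; ∈-cartesianProductWith⁻ )
open import Data.List.Membership.Propositional.Properties.WithK using (unique∧set⇒bag)
open import Data.List.Relation.Binary.BagAndSetEquality using (∼bag⇒↭)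
open import Data.List.Relation.Binary.Permutation.Propositional using (_↭_)
import Data.List.Relation.Binary.Permutation.Propositional.Properties as ↭
open import Data.List.Relation.Unary.All as All using (All; []; _∷_)
import Data.List.Relation.Unary.All.Properties as Allₚ
open import Data.List.Relation.Unary.Any as Any using (Any; here; there)
open import Data.List.Relation.Unary.Unique.Propositional using (Unique)
import Data.List.Relation.Unary.Unique.Propositional.Properties as Unique
open import Data.List.Relation.Unary.AllPairs using ([]; _∷_)
open import Data.Sum using (_⊎_; inj₁; inj₂)
open import Data.Vec as Vec using (Vec; []; _∷_; _∷ʳ_; lookup; insertAt; toList)
open import Data.Vec.Properties
  using ( ∷-injective; lookup-map; insertAt-lookup; insertAt-punchIn; lookup∘tabulate
        ; tabulate∘lookup; tabulate-cong; toList-∷ʳ; toList-map )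
open import Data.Vec.Membership.Propositional.Properties using (∈-lookup; ∈-toList⁺)
open import Data.Product using (∃₂; ∃-syntax; _×_; _,_; proj₁; proj₂)
open import Function using (_∘_; case_of_)
open import Function.Bundles using (_⇔_; mk⇔; Equivalence)
open import Relation.Binary.PropositionalEquality
  using (_≡_; _≢_; refl; sym; trans; cong; cong₂; subst; module ≡-Reasoning)
open import Relation.Nullary using (yes; no; contradiction)

private variable
  A B C : Set
  n : ℕ

concatMap-map≡cartesianProductWith : ∀ (f : A → B → C) xs ys →
  concatMap (λ x → map (f x) ys) xs ≡ cartesianProductWith f xs ys
concatMap-map≡cartesianProductWith f []       ys = refl
concatMap-map≡cartesianProductWith f (x ∷ xs) ys =
  cong (map (f x) ys ++_) (concatMap-map≡cartesianProductWith f xs ys)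

sum-map-cartesianProductWith : ∀ (h : C → ℕ) (f : A → B → C) xs ys →
  sum (map h (cartesianProductWith f xs ys)) ≡ sum (map (λ x → sum (map (h ∘ f x) ys)) xs)
sum-map-cartesianProductWith h f []       ys = refl
sum-map-cartesianProductWith h f (x ∷ xs) ys = begin
  sum (map h (map (f x) ys ++ cartesianProductWith f xs ys))
    ≡⟨ cong sum (map-++ h (map (f x) ys) _) ⟩
  sum (map h (map (f x) ys) ++ map h (cartesianProductWith f xs ys))
    ≡⟨ sum-++ (map h (map (f x) ys)) _ ⟩
  sum (map h (map (f x) ys)) + sum (map h (cartesianProductWith f xs ys))
    ≡⟨ cong₂ _+_ (cong sum (sym (map-∘ ys))) (sum-map-cartesianProductWith h f xs ys) ⟩
  sum (map (h ∘ f x) ys) + sum (map (λ x → sum (map (h ∘ f x) ys)) xs) ∎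
  where open ≡-Reasoning

sum-map-*ˡ : ∀ k (f : A → ℕ) xs → sum (map (λ x → k * f x) xs) ≡ k * sum (map f xs)
sum-map-*ˡ k f []       = sym (*-zeroʳ k)
sum-map-*ˡ k f (x ∷ xs) =
  trans (cong (k * f x +_) (sum-map-*ˡ k f xs)) (sym (*-distribˡ-+ k (f x) _))

sum-tabulate-const : ∀ n {k} (f : Fin n → ℕ) → (∀ i → f i ≡ k) → sum (tabulate f) ≡ n * k
sum-tabulate-const zero    f eq = refl
sum-tabulate-const (suc n) f eq =
  cong₂ _+_ (eq Fin.zero) (sum-tabulate-const n (f ∘ Fin.suc) (eq ∘ Fin.suc))

product-map-upTo-suc : ∀ (f : ℕ → ℕ) n →
  product (map f (upTo (suc n))) ≡ product (map f (upTo n)) * f n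
product-map-upTo-suc f n = begin
  product (map f (upTo (suc n)))
    ≡˘⟨ cong (product ∘ map f) (upTo-∷ʳ n) ⟩
  product (map f (upTo n ++ [ n ]))
    ≡⟨ cong product (map-++ f (upTo n) [ n ]) ⟩
  product (map f (upTo n) ++ [ f n ])
    ≡⟨ product-++ (map f (upTo n)) [ f n ] ⟩
  product (map f (upTo n)) * (f n * 1)
    ≡⟨ cong (product (map f (upTo n)) *_) (*-identityʳ (f n)) ⟩
  product (map f (upTo n)) * f n ∎
  where open ≡-Reasoning

lookup-extensionality : {xs ys : Vec A n} → (∀ i → lookup xs i ≡ lookup ys i) → xs ≡ ys
lookup-extensionality {xs = xs} {ys} eq =
  trans (sym (tabulate∘lookup xs)) (trans (tabulate-cong eq) (tabulate∘lookup ys))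

lookup-∷ʳ-fromℕ : ∀ (xs : Vec A n) x → lookup (xs ∷ʳ x) (fromℕ n) ≡ x
lookup-∷ʳ-fromℕ []       x = refl
lookup-∷ʳ-fromℕ (_ ∷ xs) x = lookup-∷ʳ-fromℕ xs x

lookup-∷ʳ-inject₁ : ∀ (xs : Vec A n) x i → lookup (xs ∷ʳ x) (inject₁ i) ≡ lookup xs i
lookup-∷ʳ-inject₁ (_ ∷ xs) x Fin.zero    = refl
lookup-∷ʳ-inject₁ (_ ∷ xs) x (Fin.suc i) = lookup-∷ʳ-inject₁ xs x i

≢fromℕ⇒inject₁ : ∀ (i : Fin (suc n)) → i ≢ fromℕ n → ∃[ j ] i ≡ inject₁ j
≢fromℕ⇒inject₁ i i≢top with view i
... | ‵fromℕ     = contradiction refl i≢top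
... | ‵inject₁ j = j , refl

map-toList-insertAt : ∀ (f : A → B) (xs : Vec A n) i x →
  ∃₂ λ l₁ l₂ → map f (toList (insertAt xs i x)) ≡ l₁ ++ f x ∷ l₂ × map f (toList xs) ≡ l₁ ++ l₂
map-toList-insertAt f xs        Fin.zero    x = [] , map f (toList xs) , refl , refl
map-toList-insertAt f (y ∷ xs) (Fin.suc i) x with map-toList-insertAt f xs i x
... | l₁ , l₂ , inserted , original =
  f y ∷ l₁ , l₂ , cong (f y ∷_) inserted , cong (f y ∷_) original

ltrMinima : ℕ → List ℕ → ℕ
ltrMinima b []      = 0
ltrMinima b (y ∷ l) with y <? b
... | yes _ = suc (ltrMinima y l)
... | no  _ = ltrMinima b l

ltrMinima-order-invariant : ∀ (f g : A → ℕ) {b c} →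
  (∀ y → f y < b ⇔ g y < c) → (∀ x y → f x < f y ⇔ g x < g y) →
  ∀ l → ltrMinima b (map f l) ≡ ltrMinima c (map g l)
ltrMinima-order-invariant f g bounds order [] = refl
ltrMinima-order-invariant f g {b} {c} bounds order (y ∷ l) with f y <? b | g y <? c
... | yes _  | yes _  = cong suc (ltrMinima-order-invariant f g (λ x → order x y) order l)
... | no  _  | no  _  = ltrMinima-order-invariant f g bounds order l
... | yes p  | no ¬q = contradiction (Equivalence.to (bounds y) p) ¬q
... | no ¬p | yes q  = contradiction (Equivalence.from (bounds y) q) ¬p

ltrMinima-++-∷-skip : ∀ b l₁ z l₂ → b ≤ z ⊎ Any (_≤ z) l₁ →
  ltrMinima b (l₁ ++ z ∷ l₂) ≡ ltrMinima b (l₁ ++ l₂)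
ltrMinima-++-∷-skip b [] z l₂ (inj₁ b≤z) with z <? b
... | yes z<b = contradiction b≤z (<⇒≱ z<b)
... | no  _   = refl
ltrMinima-++-∷-skip b (y ∷ l₁) z l₂ z≥min with y <? b
... | yes y<b = cong suc (ltrMinima-++-∷-skip y l₁ z l₂ (below z≥min))
  where
  below : b ≤ z ⊎ Any (_≤ z) (y ∷ l₁) → y ≤ z ⊎ Any (_≤ z) l₁
  below (inj₁ b≤z)         = inj₁ (≤-trans (<⇒≤ y<b) b≤z)
  below (inj₂ (here y≤z))  = inj₁ y≤z
  below (inj₂ (there z≥l)) = inj₂ z≥l
... | no  y≮b = ltrMinima-++-∷-skip b l₁ z l₂ (below z≥min)
  where
  below : b ≤ z ⊎ Any (_≤ z) (y ∷ l₁) → b ≤ z ⊎ Any (_≤ z) l₁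
  below (inj₁ b≤z)         = inj₁ b≤z
  below (inj₂ (here y≤z))  = inj₁ (≤-trans (≮⇒≥ y≮b) y≤z)
  below (inj₂ (there z≥l)) = inj₂ z≥l

ltrMinima-∷ʳ-minimum : ∀ l {z b} → All (z <_) l → z < b →
  ltrMinima b (l ++ [ z ]) ≡ suc (ltrMinima b l)
ltrMinima-∷ʳ-minimum [] {z} {b} [] z<b with z <? b
... | yes _   = refl
... | no  z≮b = contradiction z<b z≮b
ltrMinima-∷ʳ-minimum (y ∷ l) {b = b} (z<y ∷ z<l) z<b with y <? b
... | yes _ = cong suc (ltrMinima-∷ʳ-minimum l z<l z<y)
... | no  _ = ltrMinima-∷ʳ-minimum l z<l z<b

ltrMinima-∷-< : ∀ {y b} l → y < b → ltrMinima b (y ∷ l) ≡ suc (ltrMinima y l)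
ltrMinima-∷-< {y} {b} l y<b with y <? b
... | yes _   = refl
... | no  y≮b = contradiction y<b y≮b

firstPileSize-patience : ∀ {m} (p : List⁺ (Fin m)) ps l →
  firstPileSize (foldl (λ qs x → place x qs) (p ∷ ps) l)
    ≡ length⁺ p + ltrMinima (toℕ (top p)) (map toℕ l)
firstPileSize-patience p ps []      = sym (+-identityʳ _)
firstPileSize-patience p ps (x ∷ l) with x <ᶠ? top p
... | yes _ = trans (firstPileSize-patience (x ∷⁺ p) ps l)
                    (sym (+-suc (length⁺ p) (ltrMinima (toℕ x) (map toℕ l))))
... | no  _ = firstPileSize-patience p (place x ps) l

P₁≡ltrMinima : ∀ {m} (v : Vec (Fin m) m) → P₁ v ≡ ltrMinima m (map toℕ (toList v))
P₁≡ltrMinima {m} v with toList v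
... | []    = refl
... | x ∷ l with toℕ x <? m
...   | yes _   = firstPileSize-patience [ x ]⁺ [] l
...   | no  x≮m = contradiction (toℕ<n x) x≮m

module _ {m : ℕ} where
  open ≡-Reasoning

  lastPoint : Fin (suc (suc m))
  lastPoint = fromℕ (suc m)

  shift : Fin (suc m) → Fin m → Fin (suc (suc m))
  shift a = inject₁ ∘ punchIn a

  shift-injective : ∀ a {j k} → shift a j ≡ shift a k → j ≡ k
  shift-injective a = punchIn-injective a _ _ ∘ inject₁-injective

  inject₁≢shift : ∀ a j → inject₁ a ≢ shift a j
  inject₁≢shift a j = punchInᵢ≢i a j ∘ sym ∘ inject₁-injective

  -- The involution pairing lastPoint with a and acting on the other points, renumbered by
  -- shift a, as w.
  addPair : Fin (suc m) → Vec (Fin m) m → Vec (Fin (suc (suc m))) (suc (suc m))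
  addPair a w = insertAt (Vec.map (shift a) w) a lastPoint ∷ʳ inject₁ a

  lookup-addPair-lastPoint : ∀ a w → lookup (addPair a w) lastPoint ≡ inject₁ a
  lookup-addPair-lastPoint a w =
    lookup-∷ʳ-fromℕ (insertAt (Vec.map (shift a) w) a lastPoint) (inject₁ a)

  lookup-addPair-inject₁ : ∀ a w → lookup (addPair a w) (inject₁ a) ≡ lastPoint
  lookup-addPair-inject₁ a w = trans
    (lookup-∷ʳ-inject₁ (insertAt (Vec.map (shift a) w) a lastPoint) (inject₁ a) a)
    (insertAt-lookup (Vec.map (shift a) w) a lastPoint)

  lookup-addPair-shift : ∀ a w j → lookup (addPair a w) (shift a j) ≡ shift a (lookup w j)
  lookup-addPair-shift a w j = trans
    (lookup-∷ʳ-inject₁ (insertAt (Vec.map (shift a) w) a lastPoint) (inject₁ a) (punchIn a j))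
    (trans (insertAt-punchIn (Vec.map (shift a) w) a lastPoint j) (lookup-map j (shift a) w))

  data Position (a : Fin (suc m)) : Fin (suc (suc m)) → Set where
    atLast    : Position a lastPoint
    atPartner : Position a (inject₁ a)
    shifted   : ∀ j → Position a (shift a j)

  position : ∀ a i → Position a i
  position a i with view i
  ... | ‵fromℕ     = atLast
  ... | ‵inject₁ k with a ≟ᶠ k
  ...   | yes refl = atPartner
  ...   | no  a≢k  = subst (Position a ∘ inject₁) (punchIn-punchOut a≢k) (shifted (punchOut a≢k))

  shift-surjective : ∀ a i → i ≢ lastPoint → i ≢ inject₁ a → ∃[ j ] i ≡ shift a j
  shift-surjective a i i≢last i≢a with position a i
  ... | atLast    = contradiction refl i≢last
  ... | atPartner = contradiction refl i≢a
  ... | shifted j = j , refl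

  addPair-isFPF : ∀ a w → IsFPFInvolution w → IsFPFInvolution (addPair a w)
  addPair-isFPF a w w-fpf i with position a i
  ... | atLast rewrite lookup-addPair-lastPoint a w =
    lookup-addPair-inject₁ a w , fromℕ≢inject₁ ∘ sym
  ... | atPartner rewrite lookup-addPair-inject₁ a w =
    lookup-addPair-lastPoint a w , fromℕ≢inject₁
  ... | shifted j rewrite lookup-addPair-shift a w j | lookup-addPair-shift a w (lookup w j) =
    cong (shift a) (proj₁ (w-fpf j)) , proj₂ (w-fpf j) ∘ shift-injective a

  addPair-injectiveˡ : ∀ {a b w w′} → addPair a w ≡ addPair b w′ → a ≡ b
  addPair-injectiveˡ {a} {b} {w} {w′} eq = inject₁-injective (begin
    inject₁ a                        ≡˘⟨ lookup-addPair-lastPoint a w ⟩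
    lookup (addPair a w) lastPoint   ≡⟨ cong (λ v → lookup v lastPoint) eq ⟩
    lookup (addPair b w′) lastPoint  ≡⟨ lookup-addPair-lastPoint b w′ ⟩
    inject₁ b                        ∎)

  addPair-injectiveʳ : ∀ {a w w′} → addPair a w ≡ addPair a w′ → w ≡ w′
  addPair-injectiveʳ {a} {w} {w′} eq = lookup-extensionality λ j → shift-injective a (begin
    shift a (lookup w j)               ≡˘⟨ lookup-addPair-shift a w j ⟩
    lookup (addPair a w) (shift a j)   ≡⟨ cong (λ v → lookup v (shift a j)) eq ⟩
    lookup (addPair a w′) (shift a j)  ≡⟨ lookup-addPair-shift a w′ j ⟩
    shift a (lookup w′ j)              ∎)

  addPair-injective : ∀ {a b w w′} → addPair a w ≡ addPair b w′ → a ≡ b × w ≡ w′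
  addPair-injective eq with refl ← addPair-injectiveˡ eq = refl , addPair-injectiveʳ eq

  module RemoveLastPair {v : Vec (Fin (suc (suc m))) (suc (suc m))}
                        (v-fpf : IsFPFInvolution v) where

    v-involutive : ∀ i → lookup v (lookup v i) ≡ i
    v-involutive = proj₁ ∘ v-fpf

    private
      partnerOfLast : ∃[ a ] lookup v lastPoint ≡ inject₁ a
      partnerOfLast = ≢fromℕ⇒inject₁ (lookup v lastPoint) (proj₂ (v-fpf lastPoint))

    a : Fin (suc m)
    a = proj₁ partnerOfLast

    v-lastPoint : lookup v lastPoint ≡ inject₁ a
    v-lastPoint = proj₂ partnerOfLast

    v-partner : lookup v (inject₁ a) ≡ lastPoint
    v-partner = trans (cong (lookup v) (sym v-lastPoint)) (v-involutive lastPoint)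

    v-shift≢lastPoint : ∀ j → lookup v (shift a j) ≢ lastPoint
    v-shift≢lastPoint j eq = inject₁≢shift a j (begin
      inject₁ a                        ≡˘⟨ v-lastPoint ⟩
      lookup v lastPoint               ≡˘⟨ cong (lookup v) eq ⟩
      lookup v (lookup v (shift a j))  ≡⟨ v-involutive (shift a j) ⟩
      shift a j                        ∎)

    v-shift≢partner : ∀ j → lookup v (shift a j) ≢ inject₁ a
    v-shift≢partner j eq = fromℕ≢inject₁ (begin
      lastPoint                        ≡˘⟨ v-partner ⟩
      lookup v (inject₁ a)             ≡˘⟨ cong (lookup v) eq ⟩
      lookup v (lookup v (shift a j))  ≡⟨ v-involutive (shift a j) ⟩
      shift a j                        ∎)

    private
      image : ∀ j → ∃[ k ] lookup v (shift a j) ≡ shift a k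
      image j = shift-surjective a (lookup v (shift a j)) (v-shift≢lastPoint j) (v-shift≢partner j)

    w : Vec (Fin m) m
    w = Vec.tabulate (proj₁ ∘ image)

    v-shift : ∀ j → lookup v (shift a j) ≡ shift a (lookup w j)
    v-shift j = trans (proj₂ (image j)) (cong (shift a) (sym (lookup∘tabulate _ j)))

    w-fpf : IsFPFInvolution w
    w-fpf j = involutive , proj₂ (v-fpf (shift a j)) ∘ trans (v-shift j) ∘ cong (shift a)
      where
      involutive : lookup w (lookup w j) ≡ j
      involutive = shift-injective a (begin
        shift a (lookup w (lookup w j))  ≡˘⟨ v-shift (lookup w j) ⟩
        lookup v (shift a (lookup w j))  ≡˘⟨ cong (lookup v) (v-shift j) ⟩
        lookup v (lookup v (shift a j))  ≡⟨ v-involutive (shift a j) ⟩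
        shift a j                        ∎)

    v≡addPair : v ≡ addPair a w
    v≡addPair = lookup-extensionality λ i → agree i (position a i)
      where
      agree : ∀ i → Position a i → lookup v i ≡ lookup (addPair a w) i
      agree _ atLast      = trans v-lastPoint (sym (lookup-addPair-lastPoint a w))
      agree _ atPartner   = trans v-partner (sym (lookup-addPair-inject₁ a w))
      agree _ (shifted j) = trans (v-shift j) (sym (lookup-addPair-shift a w j))

  addPair-surjective : ∀ v → IsFPFInvolution v → ∃₂ λ a w → IsFPFInvolution w × v ≡ addPair a w
  addPair-surjective v v-fpf = a , w , w-fpf , v≡addPair
    where open RemoveLastPair {v} v-fpf

module _ {m : ℕ} where
  open ≡-Reasoning

  shift-<⇔ : ∀ a (x y : Fin m) → toℕ (shift a x) < toℕ (shift a y) ⇔ toℕ x < toℕ y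
  shift-<⇔ a x y rewrite toℕ-inject₁ (punchIn a x) | toℕ-inject₁ (punchIn a y) = mk⇔
    (λ p → ≰⇒> (<⇒≱ p ∘ punchIn-mono-≤ a y x))
    (λ p → ≰⇒> (<⇒≱ p ∘ punchIn-cancel-≤ a y x))

  ltrMinima-shift : ∀ a (w : Vec (Fin m) m) {b} → (∀ j → toℕ (shift a j) < b) →
    ltrMinima b (map (toℕ ∘ shift a) (toList w)) ≡ ltrMinima m (map toℕ (toList w))
  ltrMinima-shift a w below = ltrMinima-order-invariant (toℕ ∘ shift a) toℕ
    (λ j → mk⇔ (λ _ → toℕ<n j) (λ _ → below j)) (shift-<⇔ a) (toList w)

  toℕs-shift : ∀ a (w : Vec (Fin m) m) →
    map toℕ (toList (Vec.map (shift a) w)) ≡ map (toℕ ∘ shift a) (toList w)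
  toℕs-shift a w = trans (cong (map toℕ) (toList-map (shift a) w)) (sym (map-∘ (toList w)))

  toℕs-addPair : ∀ (a : Fin (suc m)) w → map toℕ (toList (addPair a w))
    ≡ map toℕ (toList (insertAt (Vec.map (shift a) w) a lastPoint)) ++ [ toℕ a ]
  toℕs-addPair a w = begin
    map toℕ (toList (xs ∷ʳ inject₁ a))
      ≡⟨ cong (map toℕ) (toList-∷ʳ (inject₁ a) xs) ⟩
    map toℕ (toList xs ++ [ inject₁ a ])
      ≡⟨ map-++ toℕ (toList xs) [ inject₁ a ] ⟩
    map toℕ (toList xs) ++ [ toℕ (inject₁ a) ]
      ≡⟨ cong (λ k → map toℕ (toList xs) ++ [ k ]) (toℕ-inject₁ a) ⟩
    map toℕ (toList xs) ++ [ toℕ a ] ∎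
    where xs = insertAt (Vec.map (shift a) w) a lastPoint

  P₁-addPair-zero : ∀ (w : Vec (Fin m) m) → P₁ (addPair Fin.zero w) ≡ 2 + P₁ w
  P₁-addPair-zero w = begin
    P₁ (addPair Fin.zero w)
      ≡⟨ P₁≡ltrMinima (addPair Fin.zero w) ⟩
    ltrMinima (2 + m) (map toℕ (toList (addPair Fin.zero w)))
      ≡⟨ cong (ltrMinima (2 + m)) (toℕs-addPair Fin.zero w) ⟩
    ltrMinima (2 + m) (toℕ (lastPoint {m}) ∷ map toℕ (toList (Vec.map (shift Fin.zero) w)) ++ [ 0 ])
      ≡⟨ cong₂ (λ t l → ltrMinima (2 + m) (t ∷ l ++ [ 0 ]))
               (toℕ-fromℕ (suc m)) (toℕs-shift Fin.zero w) ⟩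
    ltrMinima (2 + m) (suc m ∷ ws ++ [ 0 ])
      ≡⟨ ltrMinima-∷-< (ws ++ [ 0 ]) ≤-refl ⟩
    suc (ltrMinima (suc m) (ws ++ [ 0 ]))
      ≡⟨ cong suc (ltrMinima-∷ʳ-minimum ws (Allₚ.map⁺ (All.universal (λ _ → z<s) (toList w))) z<s) ⟩
    2 + ltrMinima (suc m) ws
      ≡⟨ cong (2 +_) (ltrMinima-shift Fin.zero w (inject₁ℕ< ∘ punchIn Fin.zero)) ⟩
    2 + ltrMinima m (map toℕ (toList w))
      ≡˘⟨ cong (2 +_) (P₁≡ltrMinima w) ⟩
    2 + P₁ w ∎
    where ws = map (toℕ ∘ shift Fin.zero) (toList w)

∈-toList-involution : ∀ {m} {w : Vec (Fin m) m} → IsFPFInvolution w → ∀ i → i ∈ toList w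
∈-toList-involution {w = w} w-fpf i =
  subst (_∈ toList w) (proj₁ (w-fpf i)) (∈-toList⁺ (∈-lookup (lookup w i) w))

ltrMinima-addPair-suc : ∀ {m} (a : Fin m) (w : Vec (Fin m) m) →
  ltrMinima (2 + m) (map toℕ (toList (addPair (Fin.suc a) w)))
    ≡ ltrMinima (2 + m) (map (toℕ ∘ shift (Fin.suc a)) (toList w) ++ [ toℕ (Fin.suc a) ])
ltrMinima-addPair-suc {suc m} a w@(w₀ ∷ w′)
  with map-toList-insertAt toℕ (Vec.map (shift (Fin.suc a)) w′) a lastPoint
... | l₁ , l₂ , inserted , original = begin
  ltrMinima N (map toℕ (toList (addPair a′ w)))
    ≡⟨ cong (ltrMinima N) (toℕs-addPair a′ w) ⟩
  ltrMinima N ((e₀ ∷ map toℕ (toList (insertAt (Vec.map (shift a′) w′) a lastPoint))) ++ [ t ])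
    ≡⟨ cong (λ l → ltrMinima N ((e₀ ∷ l) ++ [ t ])) inserted ⟩
  ltrMinima N ((e₀ ∷ l₁ ++ peak ∷ l₂) ++ [ t ])
    ≡⟨ cong (ltrMinima N) (++-assoc (e₀ ∷ l₁) (peak ∷ l₂) [ t ]) ⟩
  ltrMinima N ((e₀ ∷ l₁) ++ peak ∷ l₂ ++ [ t ])
    ≡⟨ ltrMinima-++-∷-skip N (e₀ ∷ l₁) peak (l₂ ++ [ t ]) (inj₂ (here (≤fromℕ (shift a′ w₀)))) ⟩
  ltrMinima N ((e₀ ∷ l₁) ++ l₂ ++ [ t ])
    ≡˘⟨ cong (ltrMinima N) (++-assoc (e₀ ∷ l₁) l₂ [ t ]) ⟩
  ltrMinima N ((e₀ ∷ l₁ ++ l₂) ++ [ t ])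
    ≡˘⟨ cong (λ l → ltrMinima N ((e₀ ∷ l) ++ [ t ])) original ⟩
  ltrMinima N (map toℕ (toList (Vec.map (shift a′) w)) ++ [ t ])
    ≡⟨ cong (λ l → ltrMinima N (l ++ [ t ])) (toℕs-shift a′ w) ⟩
  ltrMinima N (map (toℕ ∘ shift a′) (toList w) ++ [ t ]) ∎
  where
  open ≡-Reasoning
  a′ : Fin (suc (suc m))
  a′ = Fin.suc a
  N e₀ t peak : ℕ
  N    = 2 + suc m
  e₀   = toℕ (shift a′ w₀)
  t    = toℕ a′
  peak = toℕ (lastPoint {suc m})

P₁-addPair-suc : ∀ {m} (a : Fin m) (w : Vec (Fin m) m) → IsFPFInvolution w →
  P₁ (addPair (Fin.suc a) w) ≡ P₁ w
P₁-addPair-suc {m@(suc _)} a w w-fpf = begin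
  P₁ (addPair a′ w)
    ≡⟨ P₁≡ltrMinima (addPair a′ w) ⟩
  ltrMinima (2 + m) (map toℕ (toList (addPair a′ w)))
    ≡⟨ ltrMinima-addPair-suc a w ⟩
  ltrMinima (2 + m) (ws ++ [ toℕ a′ ])
    ≡⟨ ltrMinima-++-∷-skip (2 + m) ws (toℕ a′) [] (inj₂ smallerEntry) ⟩
  ltrMinima (2 + m) (ws ++ [])
    ≡⟨ cong (ltrMinima (2 + m)) (++-identityʳ ws) ⟩
  ltrMinima (2 + m) ws
    ≡⟨ ltrMinima-shift a′ w (toℕ<n ∘ shift a′) ⟩
  ltrMinima m (map toℕ (toList w))
    ≡˘⟨ P₁≡ltrMinima w ⟩
  P₁ w ∎
  where
  open ≡-Reasoning
  a′ : Fin (suc m)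
  a′ = Fin.suc a
  ws : List ℕ
  ws = map (toℕ ∘ shift a′) (toList w)
  smallerEntry : Any (_≤ toℕ a′) ws
  smallerEntry = Any.map (λ eq → subst (_≤ toℕ a′) eq z≤n)
    (∈-map⁺ (toℕ ∘ shift a′) (∈-toList-involution w-fpf Fin.zero))

allVecs-suc : ∀ m k → allVecs m (suc k) ≡ cartesianProductWith _∷_ (allFin m) (allVecs m k)
allVecs-suc m k = concatMap-map≡cartesianProductWith _∷_ (allFin m) (allVecs m k)

allVecs-unique : ∀ m k → Unique (allVecs m k)
allVecs-unique m zero    = [] ∷ []
allVecs-unique m (suc k) rewrite allVecs-suc m k =
  Unique.cartesianProductWith⁺ _∷_ ∷-injective (Unique.allFin⁺ m) (allVecs-unique m k)

∈-allVecs : ∀ m k (v : Vec (Fin m) k) → v ∈ allVecs m k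
∈-allVecs m zero    []      = here refl
∈-allVecs m (suc k) (i ∷ v) rewrite allVecs-suc m k =
  ∈-cartesianProductWith⁺ _∷_ (∈-allFin i) (∈-allVecs m k v)

FPFInvolutions-unique : ∀ m → Unique (FPFInvolutions m)
FPFInvolutions-unique m = Unique.filter⁺ isFPFInvolution? (allVecs-unique m m)

∈-FPFInvolutions : ∀ {m} {v : Vec (Fin m) m} → v ∈ FPFInvolutions m ⇔ IsFPFInvolution v
∈-FPFInvolutions {m} {v} = mk⇔
  (proj₂ ∘ ∈-filter⁻ isFPFInvolution? {xs = allVecs m m})
  (∈-filter⁺ isFPFInvolution? (∈-allVecs m m v))

FPFInvolutions-↭ : ∀ m → FPFInvolutions (suc (suc m))
  ↭ cartesianProductWith addPair (allFin (suc m)) (FPFInvolutions m)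
FPFInvolutions-↭ m = ∼bag⇒↭ (unique∧set⇒bag
  (FPFInvolutions-unique (suc (suc m)))
  (Unique.cartesianProductWith⁺ addPair addPair-injective
    (Unique.allFin⁺ (suc m)) (FPFInvolutions-unique m))
  (mk⇔ decompose compose))
  where
  pairs : List (Vec (Fin (suc (suc m))) (suc (suc m)))
  pairs = cartesianProductWith addPair (allFin (suc m)) (FPFInvolutions m)

  decompose : ∀ {v} → v ∈ FPFInvolutions (suc (suc m)) → v ∈ pairs
  decompose {v} v∈ = case addPair-surjective v (Equivalence.to ∈-FPFInvolutions v∈) of λ where
    (a , w , w-fpf , v≡) → subst (_∈ pairs) (sym v≡)
      (∈-cartesianProductWith⁺ addPair (∈-allFin a) (Equivalence.from ∈-FPFInvolutions w-fpf))

  compose : ∀ {v} → v ∈ pairs → v ∈ FPFInvolutions (suc (suc m))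
  compose v∈ = case ∈-cartesianProductWith⁻ addPair (allFin (suc m)) (FPFInvolutions m) v∈
    of λ where
    (a , w , _ , w∈ , v≡) → subst (_∈ FPFInvolutions (suc (suc m))) (sym v≡)
      (Equivalence.from ∈-FPFInvolutions (addPair-isFPF a w (Equivalence.to ∈-FPFInvolutions w∈)))

P₁-sum : ℕ → ℕ → ℕ
P₁-sum x m = sum (map (λ π → x ^ P₁ π) (FPFInvolutions m))

P₁-sum-recurrence : ∀ x m → P₁-sum x (2 + m) ≡ (x ^ 2 + m) * P₁-sum x m
P₁-sum-recurrence x m = begin
  P₁-sum x (2 + m)
    ≡⟨ sum-↭ (↭.map⁺ weight (FPFInvolutions-↭ m)) ⟩
  sum (map weight (cartesianProductWith addPair (allFin (suc m)) (FPFInvolutions m)))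
    ≡⟨ sum-map-cartesianProductWith weight addPair (allFin (suc m)) (FPFInvolutions m) ⟩
  pairedWith Fin.zero + sum (map pairedWith (tabulate Fin.suc))
    ≡⟨ cong₂ _+_ pairedWith-zero (trans (cong sum (map-tabulate Fin.suc pairedWith))
                                        (sum-tabulate-const m _ pairedWith-suc)) ⟩
  x ^ 2 * P₁-sum x m + m * P₁-sum x m
    ≡˘⟨ *-distribʳ-+ (P₁-sum x m) (x ^ 2) m ⟩
  (x ^ 2 + m) * P₁-sum x m ∎
  where
  open ≡-Reasoning
  weight : ∀ {k} → Vec (Fin k) k → ℕ
  weight π = x ^ P₁ π

  pairedWith : Fin (suc m) → ℕ
  pairedWith a = sum (map (weight ∘ addPair a) (FPFInvolutions m))

  pairedWith-zero : pairedWith Fin.zero ≡ x ^ 2 * P₁-sum x m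
  pairedWith-zero = trans
    (cong sum (map-cong (λ w → trans (cong (x ^_) (P₁-addPair-zero w)) (^-distribˡ-+-* x 2 (P₁ w)))
                        (FPFInvolutions m)))
    (sum-map-*ˡ (x ^ 2) weight (FPFInvolutions m))

  pairedWith-suc : ∀ a → pairedWith (Fin.suc a) ≡ P₁-sum x m
  pairedWith-suc a = cong sum (map-cong-local
    (All.map (λ {w} → cong (x ^_) ∘ P₁-addPair-suc a w)
             (Allₚ.all-filter isFPFInvolution? (allVecs m m))))

P₁-sum-even : ∀ x n → P₁-sum x (2 * n) ≡ product (map (λ j → x ^ 2 + 2 * j) (upTo n))
P₁-sum-even x zero    = refl
P₁-sum-even x (suc n) = begin
  P₁-sum x (2 * suc n)                     ≡⟨ cong (P₁-sum x) (*-suc 2 n) ⟩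
  P₁-sum x (2 + 2 * n)                     ≡⟨ P₁-sum-recurrence x (2 * n) ⟩
  f n * P₁-sum x (2 * n)                   ≡⟨ cong (f n *_) (P₁-sum-even x n) ⟩
  f n * product (map f (upTo n))           ≡⟨ *-comm (f n) _ ⟩
  product (map f (upTo n)) * f n           ≡˘⟨ product-map-upTo-suc f n ⟩
  product (map f (upTo (suc n)))           ∎
  where
  open ≡-Reasoning
  f : ℕ → ℕ
  f j = x ^ 2 + 2 * j

-- The identity holds for n = 0 as well.
mainTheorem12 : (n : ℕ) → 1 ≤ n → (x : ℕ) →
    sum (map (λ π → x ^ P₁ π) (FPFInvolutions (2 * n)))
      ≡ product (map (λ j → x ^ 2 + 2 * j) (upTo n))
mainTheorem12 n _ x = P₁-sum-even x n
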